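{- For every $m\ge1$ there is a bijection between the set $\widehat{\mathcal{O}}(m)$ of ordered free multilabelled increasing trees with label set $\{1,\dots,m\}$ and the set $\widetilde{\mathcal{O}}(m)$ of ordered increasing trees with $m$ nodes in which each node of out-degree $1$ is coloured either black or white.
   Context: Ordered trees are rooted trees whose children of each node are linearly ordered. An ordered free multilabelled increasing tree with label set $\{1,\dots,m\}$ is an ordered tree together with an assignment of a non-empty set of labels to each node, these sets partitioning $\{1,\dots,m\}$, such that every label of a child is larger than every label of its parent. An ordered increasing tree with $m$ nodes is an ordered tree whose nodes carry the distinct labels $1,\dots,m$ such that each child has a larger label than its parent. -}

module Defs where

open import Level using (0ℓ)
open import Data.Nat using (ℕ; suc; _<_)
open import Data.Bool using (Bool)
open import Data.Unit using (⊤)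
open import Data.List using (List; []; _∷_; _++_; map; length; upTo)
open import Data.List.Relation.Unary.All using (All)
open import Data.List.Relation.Unary.Linked using (Linked)
open import Data.List.Relation.Binary.Permutation.Propositional using (_↭_)
open import Data.Product using (Σ; proj₁; _×_)
open import Relation.Binary.Bundles using (Setoid)
open import Relation.Binary.PropositionalEquality using (_≡_; _≢_; setoid)
import Relation.Binary.Construct.On as On

labels1to : ℕ → List ℕ
labels1to m = map suc (upTo m)

-- An ordered (rose) tree whose nodes carry a finite set of labels,
-- represented canonically as a strictly increasing list.
data MTree : Set where
  mnode : List ℕ → List MTree → MTree

rootLabels : MTree → List ℕ
rootLabels (mnode ls _) = ls

mutual
  allLabelsM : MTree → List ℕ
  allLabelsM (mnode ls cs) = ls ++ allLabelsMs cs

  allLabelsMs : List MTree → List ℕ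
  allLabelsMs []       = []
  allLabelsMs (c ∷ cs) = allLabelsM c ++ allLabelsMs cs

data IncreasingM : MTree → Set where
  incM : ∀ {ls cs} →
         ls ≢ [] →
         Linked _<_ ls →
         All (λ c → All (λ l → All (λ l′ → l < l′) (rootLabels c)) ls) cs →
         All IncreasingM cs →
         IncreasingM (mnode ls cs)

OHat : ℕ → Set
OHat m = Σ MTree (λ t → IncreasingM t × (allLabelsM t ↭ labels1to m))

data BW : Set where
  black white : BW

ColourData : ℕ → Set
ColourData 1 = BW
ColourData _ = ⊤

data CTree : Set where
  cnode : ℕ → (cs : List CTree) → ColourData (length cs) → CTree

rootLabel : CTree → ℕ
rootLabel (cnode l _ _) = l

mutual
  allLabelsC : CTree → List ℕ
  allLabelsC (cnode l cs _) = l ∷ allLabelsCs cs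

  allLabelsCs : List CTree → List ℕ
  allLabelsCs []       = []
  allLabelsCs (c ∷ cs) = allLabelsC c ++ allLabelsCs cs

data IncreasingC : CTree → Set where
  incC : ∀ {l cs col} →
         All (λ c → l < rootLabel c) cs →
         All IncreasingC cs →
         IncreasingC (cnode l cs col)

-- \widetilde{O}(m): node labels are exactly 1..m (so m nodes, distinct labels)
OTilde : ℕ → Set
OTilde m = Σ CTree (λ t → IncreasingC t × (allLabelsC t ↭ labels1to m))

-- The sets as setoids: two elements are equal iff their underlying trees
-- are equal (validity proofs are irrelevant).

OHatSetoid : ℕ → Setoid 0ℓ 0ℓ
OHatSetoid m = On.setoid {B = OHat m} (setoid MTree) proj₁

OTildeSetoid : ℕ → Setoid 0ℓ 0ℓ
OTildeSetoid m = On.setoid {B = OTilde m} (setoid CTree) proj₁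

-- A node of a multilabelled tree with labels a₁ < a₂ < … < aₖ is unfolded into a
-- path a₁ → a₂ → … → aₖ whose first k − 1 nodes have out-degree 1 and are coloured
-- white, aₖ taking over the children of the original node; when aₖ itself gets
-- exactly one child it is coloured black. Conversely, merging every white node
-- with its only child recovers the multilabelled tree. Both maps preserve the
-- multiset of labels and the increasing property.
module Submission where

open import Defs
open import Data.Nat using (ℕ; _≤_; _<_; 2+)
open import Data.Nat.Properties using (<-trans)
open import Data.Unit using (tt)
open import Data.List using (List; []; _∷_; _++_; length)
open import Data.List.Properties using (++-identityʳ)
open import Data.List.Relation.Unary.All as All using (All; []; _∷_)
open import Data.List.Relation.Unary.Linked using (Linked; [-]; _∷_)
open import Data.List.Relation.Unary.Linked.Properties using (Linked⇒All)
open import Data.Product using (Σ; _,_; proj₁; _×_)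
open import Data.Empty using (⊥-elim)
open import Function.Bundles using (Bijection)
open import Data.List.Relation.Binary.Permutation.Propositional using (_↭_)
open import Relation.Binary.PropositionalEquality
import Relation.Binary.Construct.On as On

subsetBijection :
  ∀ {A B : Set} {P : A → Set} {Q : B → Set}
  (f : A → B) (g : B → A) →
  (∀ {x} → P x → Q (f x)) → (∀ {y} → Q y → P (g y)) →
  (∀ {x} → P x → g (f x) ≡ x) → (∀ {y} → Q y → f (g y) ≡ y) →
  Bijection (On.setoid {B = Σ A P} (setoid A) proj₁)
            (On.setoid {B = Σ B Q} (setoid B) proj₁)
subsetBijection {A} {B} {P} {Q} f g f-pres g-pres g∘f f∘g = record
  { to        = λ { (x , px) → f x , f-pres px }
  ; cong      = λ {x} {y} → cong f {proj₁ x} {proj₁ y}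
  ; bijective = (λ {x} {y} → injective {x} {y}) , surjective
  }
  where
  injective : ∀ {x y : Σ A P} → f (proj₁ x) ≡ f (proj₁ y) → proj₁ x ≡ proj₁ y
  injective {x , px} {y , py} fx≡fy =
    trans (sym (g∘f px)) (trans (cong g fx≡fy) (g∘f py))

  surjective : ∀ (y : Σ B Q) →
               Σ (Σ A P) λ x → ∀ {z : Σ A P} → proj₁ z ≡ proj₁ x → f (proj₁ z) ≡ proj₁ y
  surjective (y , qy) = (g y , g-pres qy) , λ z≡gy → trans (cong f z≡gy) (f∘g qy)

defaultColour : (k : ℕ) → ColourData k
defaultColour 0       = tt
defaultColour 1       = black
defaultColour (2+ _)  = tt

whiteChain : ℕ → List ℕ → List CTree → CTree
whiteChain a []       cs = cnode a cs (defaultColour (length cs))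
whiteChain a (b ∷ bs) cs = cnode a (whiteChain b bs cs ∷ []) white

mutual
  -- The first clause is junk: an increasing tree has no empty label set.
  expand : MTree → CTree
  expand (mnode []       ts) = cnode 0 [] tt
  expand (mnode (a ∷ as) ts) = whiteChain a as (expandAll ts)

  expandAll : List MTree → List CTree
  expandAll []       = []
  expandAll (t ∷ ts) = expand t ∷ expandAll ts

whitePath : CTree → List ℕ
whitePath (cnode _ (c ∷ []) white) = rootLabel c ∷ whitePath c
whitePath _                        = []

-- A single clause for merge makes its root label list definitionally start
-- with rootLabel c, which the proofs below rely on.
mutual
  merge : CTree → MTree
  merge c = mnode (rootLabel c ∷ whitePath c) (mergedChildren c)

  mergedChildren : CTree → List MTree
  mergedChildren (cnode _ (c ∷ []) white) = mergedChildren c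
  mergedChildren (cnode _ cs _)           = mergeAll cs

  mergeAll : List CTree → List MTree
  mergeAll []       = []
  mergeAll (c ∷ cs) = merge c ∷ mergeAll cs

addLabel : ℕ → MTree → MTree
addLabel l (mnode ls ts) = mnode (l ∷ ls) ts

rootLabel-whiteChain : ∀ a as cs → rootLabel (whiteChain a as cs) ≡ a
rootLabel-whiteChain a []      cs = refl
rootLabel-whiteChain a (_ ∷ _) cs = refl

merge-whiteChain : ∀ a as cs → merge (whiteChain a as cs) ≡ mnode (a ∷ as) (mergeAll cs)
merge-whiteChain a []       []           = refl
merge-whiteChain a []       (_ ∷ [])     = refl
merge-whiteChain a []       (_ ∷ _ ∷ _)  = refl
merge-whiteChain a (b ∷ bs) cs           = cong (addLabel a) (merge-whiteChain b bs cs)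

mutual
  merge∘expand : ∀ t → IncreasingM t → merge (expand t) ≡ t
  merge∘expand (mnode []       ts) (incM ls≢[] _ _ _) = ⊥-elim (ls≢[] refl)
  merge∘expand (mnode (a ∷ as) ts) (incM _ _ _ incs)  = begin
    merge (whiteChain a as (expandAll ts))
      ≡⟨ merge-whiteChain a as (expandAll ts) ⟩
    mnode (a ∷ as) (mergeAll (expandAll ts))
      ≡⟨ cong (mnode (a ∷ as)) (mergeAll∘expandAll ts incs) ⟩
    mnode (a ∷ as) ts
      ∎
    where open ≡-Reasoning

  mergeAll∘expandAll : ∀ ts → All IncreasingM ts → mergeAll (expandAll ts) ≡ ts
  mergeAll∘expandAll []       []           = refl
  mergeAll∘expandAll (t ∷ ts) (inc ∷ incs) =
    cong₂ _∷_ (merge∘expand t inc) (mergeAll∘expandAll ts incs)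

mutual
  expand∘merge : ∀ c → expand (merge c) ≡ c
  expand∘merge (cnode l []           tt)    = refl
  expand∘merge (cnode l (c ∷ [])     black) =
    cong (λ c′ → cnode l (c′ ∷ []) black) (expand∘merge c)
  expand∘merge (cnode l (c ∷ [])     white) =
    cong (λ c′ → cnode l (c′ ∷ []) white) (expand∘merge c)
  expand∘merge (cnode l (c ∷ d ∷ cs) tt)
    rewrite expand∘merge c | expand∘merge d | expandAll∘mergeAll cs = refl

  expandAll∘mergeAll : ∀ cs → expandAll (mergeAll cs) ≡ cs
  expandAll∘mergeAll []       = refl
  expandAll∘mergeAll (c ∷ cs) = cong₂ _∷_ (expand∘merge c) (expandAll∘mergeAll cs)

allLabelsC-whiteChain : ∀ a as cs →
                        allLabelsC (whiteChain a as cs) ≡ a ∷ as ++ allLabelsCs cs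
allLabelsC-whiteChain a []       cs = refl
allLabelsC-whiteChain a (b ∷ bs) cs =
  cong (a ∷_) (trans (++-identityʳ _) (allLabelsC-whiteChain b bs cs))

mutual
  allLabelsC-expand : ∀ t → IncreasingM t → allLabelsC (expand t) ≡ allLabelsM t
  allLabelsC-expand (mnode []       ts) (incM ls≢[] _ _ _) = ⊥-elim (ls≢[] refl)
  allLabelsC-expand (mnode (a ∷ as) ts) (incM _ _ _ incs)  =
    trans (allLabelsC-whiteChain a as (expandAll ts))
          (cong (λ ls → a ∷ as ++ ls) (allLabelsCs-expandAll ts incs))

  allLabelsCs-expandAll : ∀ ts → All IncreasingM ts →
                          allLabelsCs (expandAll ts) ≡ allLabelsMs ts
  allLabelsCs-expandAll []       []           = refl
  allLabelsCs-expandAll (t ∷ ts) (inc ∷ incs) =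
    cong₂ _++_ (allLabelsC-expand t inc) (allLabelsCs-expandAll ts incs)

mutual
  allLabelsM-merge : ∀ c → allLabelsM (merge c) ≡ allLabelsC c
  allLabelsM-merge (cnode l []           tt)    = refl
  allLabelsM-merge (cnode l (c ∷ [])     black) =
    cong (λ ls → l ∷ ls ++ []) (allLabelsM-merge c)
  allLabelsM-merge (cnode l (c ∷ [])     white) =
    cong (l ∷_) (trans (allLabelsM-merge c) (sym (++-identityʳ _)))
  allLabelsM-merge (cnode l (c ∷ d ∷ cs) tt)    =
    cong (l ∷_) (allLabelsMs-mergeAll (c ∷ d ∷ cs))

  allLabelsMs-mergeAll : ∀ cs → allLabelsMs (mergeAll cs) ≡ allLabelsCs cs
  allLabelsMs-mergeAll []       = refl
  allLabelsMs-mergeAll (c ∷ cs) =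
    cong₂ _++_ (allLabelsM-merge c) (allLabelsMs-mergeAll cs)

whiteChain-increasing : ∀ a as cs → Linked _<_ (a ∷ as) →
                        All (λ c → All (_< rootLabel c) (a ∷ as)) cs → All IncreasingC cs →
                        IncreasingC (whiteChain a as cs)
whiteChain-increasing a []       cs _          above incs = incC (All.map All.head above) incs
whiteChain-increasing a (b ∷ bs) cs (a<b ∷ lk) above incs =
  incC (subst (a <_) (sym (rootLabel-whiteChain b bs cs)) a<b ∷ [])
       (whiteChain-increasing b bs cs lk (All.map All.tail above) incs ∷ [])

expand-above : ∀ {l} t → IncreasingM t → All (l <_) (rootLabels t) → l < rootLabel (expand t)
expand-above (mnode []       ts) (incM ls≢[] _ _ _) _           = ⊥-elim (ls≢[] refl)
expand-above (mnode (a ∷ as) ts) _                  (l<a ∷ _)   =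
  subst (_ <_) (sym (rootLabel-whiteChain a as (expandAll ts))) l<a

expandAll-above : ∀ {ls} ts → All (λ t → All (λ l → All (l <_) (rootLabels t)) ls) ts →
                  All IncreasingM ts → All (λ c → All (_< rootLabel c) ls) (expandAll ts)
expandAll-above []       []             []           = []
expandAll-above (t ∷ ts) (above ∷ aboves) (inc ∷ incs) =
  All.map (expand-above t inc) above ∷ expandAll-above ts aboves incs

mutual
  expand-increasing : ∀ t → IncreasingM t → IncreasingC (expand t)
  expand-increasing (mnode []       ts) (incM ls≢[] _ _ _)      = ⊥-elim (ls≢[] refl)
  expand-increasing (mnode (a ∷ as) ts) (incM _ lk aboves incs) =
    whiteChain-increasing a as (expandAll ts) lk (expandAll-above ts aboves incs)
                          (expandAll-increasing ts incs)

  expandAll-increasing : ∀ ts → All IncreasingM ts → All IncreasingC (expandAll ts)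
  expandAll-increasing []       []           = []
  expandAll-increasing (t ∷ ts) (inc ∷ incs) =
    expand-increasing t inc ∷ expandAll-increasing ts incs

addLabel-increasing : ∀ {l r rs ts} → l < r → IncreasingM (mnode (r ∷ rs) ts) →
                      IncreasingM (addLabel l (mnode (r ∷ rs) ts))
addLabel-increasing l<r (incM _ lk aboves incs) =
  incM (λ ()) (l<r ∷ lk) (All.map (λ above → All.map (<-trans l<r) (All.head above) ∷ above) aboves)
       incs

mergeAll-above : ∀ {l} cs → All (λ c → l < rootLabel c) cs → All IncreasingM (mergeAll cs) →
                 All (λ t → All (λ x → All (x <_) (rootLabels t)) (l ∷ [])) (mergeAll cs)
mergeAll-above []       []           []                     = []
mergeAll-above (c ∷ cs) (l<c ∷ l<cs) (incM _ lk _ _ ∷ incs) =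
  (Linked⇒All <-trans l<c lk ∷ []) ∷ mergeAll-above cs l<cs incs

mutual
  merge-increasing : ∀ c → IncreasingC c → IncreasingM (merge c)
  merge-increasing (cnode l []           tt)    (incC l<cs incs) =
    singletonRoot-increasing [] l<cs incs
  merge-increasing (cnode l (c ∷ [])     black) (incC l<cs incs) =
    singletonRoot-increasing (c ∷ []) l<cs incs
  merge-increasing (cnode l (c ∷ [])     white) (incC (l<c ∷ []) (inc ∷ [])) =
    addLabel-increasing l<c (merge-increasing c inc)
  merge-increasing (cnode l (c ∷ d ∷ cs) tt)    (incC l<cs incs) =
    singletonRoot-increasing (c ∷ d ∷ cs) l<cs incs

  singletonRoot-increasing : ∀ {l} cs → All (λ c → l < rootLabel c) cs → All IncreasingC cs →
                             IncreasingM (mnode (l ∷ []) (mergeAll cs))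
  singletonRoot-increasing cs l<cs incs = incM (λ ()) [-] (mergeAll-above cs l<cs incs′) incs′
    where incs′ = mergeAll-increasing cs incs

  mergeAll-increasing : ∀ cs → All IncreasingC cs → All IncreasingM (mergeAll cs)
  mergeAll-increasing []       []           = []
  mergeAll-increasing (c ∷ cs) (inc ∷ incs) =
    merge-increasing c inc ∷ mergeAll-increasing cs incs

theorem7p3 : (m : ℕ) → 1 ≤ m → Bijection (OHatSetoid m) (OTildeSetoid m)
theorem7p3 m _ = subsetBijection expand merge expand-valid merge-valid
  (λ {t} (inc , _) → merge∘expand t inc)
  (λ {c} _ → expand∘merge c)
  where
  expand-valid : ∀ {t} → IncreasingM t × allLabelsM t ↭ labels1to m →
                 IncreasingC (expand t) × allLabelsC (expand t) ↭ labels1to m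
  expand-valid {t} (inc , labels↭) =
    expand-increasing t inc , subst (_↭ labels1to m) (sym (allLabelsC-expand t inc)) labels↭

  merge-valid : ∀ {c} → IncreasingC c × allLabelsC c ↭ labels1to m →
                IncreasingM (merge c) × allLabelsM (merge c) ↭ labels1to m
  merge-valid {c} (inc , labels↭) =
    merge-increasing c inc , subst (_↭ labels1to m) (sym (allLabelsM-merge c)) labels↭
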